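{- Let $n\ge 1$ and let ${\cal ORCT}_n$ be the set of full contractions of $X_n=\{1,\dots,n\}$ that are order-preserving or order-reversing. For $1\le p\le n$, the number of $\alpha\in{\cal ORCT}_n$ with $h(\alpha)=p$ is $2(n-p+1)\binom{n-1}{p-1}$ if $p>1$, and $n$ if $p=1$.
   Context: Full transformations are maps $\alpha:X_n\to X_n$, written $x\mapsto x\alpha$. Order-preserving: $x\le y\Rightarrow x\alpha\le y\alpha$; order-reversing: $x\le y\Rightarrow x\alpha\ge y\alpha$. Contraction: $|x\alpha-y\alpha|\le|x-y|$ for all $x,y$. $h(\alpha)=|\mathrm{Im}\,\alpha|$. -}

module Defs where

open import Data.Nat using (ℕ; zero; suc; _+_; _*_; _∸_)
open import Data.Nat.Combinatorics using (_C_)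
open import Data.Fin using (Fin; toℕ) renaming (_≤_ to _≤ᶠ_; _≟_ to _≟ᶠ_)
open import Data.Fin.Properties using (all?; any?) renaming (_≤?_ to _≤?ᶠ_)
open import Data.Fin.Subset using (Subset; ∣_∣)
open import Data.Integer using (ℤ; _-_; +_) renaming (∣_∣ to abs)
import Data.Nat as ℕ
import Data.Nat.Properties as ℕP
open import Data.Vec using (Vec; []; _∷_; lookup; tabulate)
open import Data.List using (List; []; _∷_; concatMap; map; length; filter)
open import Data.List using (allFin)
open import Data.Product using (_×_)
open import Data.Sum using (_⊎_)
open import Relation.Nullary using (Dec; _×-dec_; _⊎-dec_; _→-dec_)
open import Relation.Nullary.Decidable using (⌊_⌋)

-- A full transformation of X_n = {1,…,n}, with X_n represented by Fin n
-- (element i of Fin n stands for i+1) and x α written α x.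
Transformation : ℕ → Set
Transformation n = Fin n → Fin n

dist : ∀ {n} → Fin n → Fin n → ℕ
dist x y = abs ((+ toℕ x) - (+ toℕ y))

IsOrderPreserving : ∀ {n} → Transformation n → Set
IsOrderPreserving {n} α = ∀ (x y : Fin n) → x ≤ᶠ y → α x ≤ᶠ α y

IsOrderReversing : ∀ {n} → Transformation n → Set
IsOrderReversing {n} α = ∀ (x y : Fin n) → x ≤ᶠ y → α y ≤ᶠ α x

IsContraction : ∀ {n} → Transformation n → Set
IsContraction {n} α = ∀ (x y : Fin n) → dist (α x) (α y) ℕ.≤ dist x y

InORCT : ∀ {n} → Transformation n → Set
InORCT α = IsContraction α × (IsOrderPreserving α ⊎ IsOrderReversing α)

image : ∀ {n} → Transformation n → Subset n
image α = tabulate (λ y → ⌊ any? (λ x → α x ≟ᶠ y) ⌋)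

h : ∀ {n} → Transformation n → ℕ
h α = ∣ image α ∣

isOrderPreserving? : ∀ {n} (α : Transformation n) → Dec (IsOrderPreserving α)
isOrderPreserving? α = all? λ x → all? λ y → (x ≤?ᶠ y) →-dec (α x ≤?ᶠ α y)

isOrderReversing? : ∀ {n} (α : Transformation n) → Dec (IsOrderReversing α)
isOrderReversing? α = all? λ x → all? λ y → (x ≤?ᶠ y) →-dec (α y ≤?ᶠ α x)

isContraction? : ∀ {n} (α : Transformation n) → Dec (IsContraction α)
isContraction? α = all? λ x → all? λ y → dist (α x) (α y) ℕ.≤? dist x y

inORCT? : ∀ {n} (α : Transformation n) → Dec (InORCT α)
inORCT? α = isContraction? α ×-dec (isOrderPreserving? α ⊎-dec isOrderReversing? α)

-- Complete enumeration of all vectors of length k over Fin n (n^k of them,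
-- each exactly once); a full transformation α is encoded by its table.
allVecs : (k n : ℕ) → List (Vec (Fin n) k)
allVecs zero    n = [] ∷ []
allVecs (suc k) n = concatMap (λ i → map (i ∷_) (allVecs k n)) (allFin n)

allTransformations : (n : ℕ) → List (Transformation n)
allTransformations n = map lookup (allVecs n n)

countORCT : (n p : ℕ) → ℕ
countORCT n p = length (filter (λ α → inORCT? α ×-dec (h α ℕ.≟ p)) (allTransformations n))

module Submission where

-- Write n = k + 1 and identify a full transformation α of X_n with its table
-- v = (0α, …, kα) in Vec (Fin n) n.  Then:
--   * α is an order-preserving contraction iff v is a *staircase*: each entry
--     equals its predecessor or exceeds it by one.  With s rises the image is
--     the interval [0α, 0α + s], so h(α) = s + 1.
--   * Staircases with s rises are counted by choosing the s rising steps among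
--     the k steps and a first entry a with a + s < n: there are (n ∸ s)·(k C s).
--   * The reflection x ↦ opposite x of X_n turns order-reversing contractions
--     into order-preserving ones, preserves h, and permutes the tables, so
--     both kinds are equally numerous.
--   * A map of both kinds is constant, so h = 1.  Hence for p > 1 the two kinds
--     are disjoint and the count doubles, while for p = 1 every order-reversing
--     one is order-preserving and the count is n · (k C 0) = n.

open import Defs
open import Data.Bool using (true; false; if_then_else_)
open import Data.Empty using (⊥; ⊥-elim)
open import Data.Fin using (Fin; toℕ; zero; suc; opposite) renaming (_≤_ to _≤ᶠ_; _≟_ to _≟ᶠ_)
open import Data.Fin.Permutation as Perm using (Permutation; _⟨$⟩ʳ_)
open import Data.Fin.Properties using (any?; toℕ-injective; toℕ<n; opposite-prop; opposite-involutive)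
  renaming (≤-antisym to ≤ᶠ-antisym)
open import Data.Fin.Subset using (∣_∣)
import Data.Integer as ℤ
import Data.Integer.Properties as ℤ
open import Data.List using (List; []; _∷_; _++_; length; filter; concatMap; tabulate)
import Data.List as List
open import Data.List.Properties using (length-++; filter-++; filter-≐)
open import Data.Nat using (ℕ; zero; suc; _+_; _*_; _∸_; _≤_; _<_; z≤n; s≤s; s≤s⁻¹; _≟_; _≤?_; _<?_; ∣_-_∣)
open import Data.Nat.Combinatorics using (_C_; nCk+nC[k+1]≡[n+1]C[k+1])
open import Data.Nat.Properties
open import Data.Product using (_×_; _,_; proj₁; proj₂; ∃-syntax; uncurry; map₂)
import Data.Product as Product
open import Data.Sum using (_⊎_; inj₁; inj₂; [_,_]′)
open import Data.Vec using (Vec; []; _∷_; lookup; map)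
import Data.Vec as Vec
open import Data.Vec.Properties using (lookup-map)
open import Function using (_∘_)
open import Relation.Binary.PropositionalEquality
  using (_≡_; refl; sym; trans; cong; cong₂; subst; subst₂; module ≡-Reasoning)
open import Relation.Nullary using (Dec; yes; no; does; ¬_; _×-dec_; _⊎-dec_)
open import Relation.Nullary.Decidable using (map′; ⌊_⌋)
open import Relation.Unary using (Decidable; _≐_)
open import Algebra.Properties.CommutativeMonoid.Sum +-0-commutativeMonoid
  using (sum; sum-syntax; sum-cong-≗; sum-replicate-zero; ∑-distrib-+; sum-permute)
open import Algebra.Properties.Semiring.Sum +-*-semiring using (*-distribʳ-sum)

𝟙 : {A : Set} → Dec A → ℕ
𝟙 d = if does d then 1 else 0

𝟙-yes : ∀ {A : Set} (A? : Dec A) → A → 𝟙 A? ≡ 1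
𝟙-yes (yes _) _ = refl
𝟙-yes (no ¬a) a = ⊥-elim (¬a a)

𝟙-no : ∀ {A : Set} (A? : Dec A) → ¬ A → 𝟙 A? ≡ 0
𝟙-no (yes a) ¬a = ⊥-elim (¬a a)
𝟙-no (no _)  _  = refl

𝟙-cong : {A B : Set} (A? : Dec A) (B? : Dec B) → (A → B) → (B → A) → 𝟙 A? ≡ 𝟙 B?
𝟙-cong (yes _) (yes _) _ _ = refl
𝟙-cong (no _)  (no _)  _ _ = refl
𝟙-cong (yes a) (no ¬b) f _ = ⊥-elim (¬b (f a))
𝟙-cong (no ¬a) (yes b) _ g = ⊥-elim (¬a (g b))


count : {A : Set} {P : A → Set} → Decidable P → List A → ℕ
count P? xs = length (filter P? xs)

count-cong : {A : Set} {P Q : A → Set} (P? : Decidable P) (Q? : Decidable Q) →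
             P ≐ Q → ∀ xs → count P? xs ≡ count Q? xs
count-cong P? Q? P≐Q xs = cong length (filter-≐ P? Q? P≐Q xs)

module _ {A : Set} {P : A → Set} (P? : Decidable P) where

  count-++ : ∀ xs ys → count P? (xs ++ ys) ≡ count P? xs + count P? ys
  count-++ xs ys = trans (cong length (filter-++ P? xs ys)) (length-++ (filter P? xs))

  count-guard : {B : Set} (B? : Dec B) → ∀ xs → count (λ x → B? ×-dec P? x) xs ≡ 𝟙 B? * count P? xs
  count-guard (yes b) xs = trans (count-cong _ P? (proj₂ , (b ,_)) xs) (sym (*-identityˡ _))
  count-guard (no ¬b) []       = refl
  count-guard (no ¬b) (x ∷ xs) = count-guard (no ¬b) xs

  count-⊎ : {Q : A → Set} (Q? : Decidable Q) → (∀ {x} → P x → Q x → ⊥) →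
            ∀ xs → count (λ x → P? x ⊎-dec Q? x) xs ≡ count P? xs + count Q? xs
  count-⊎ Q? disjoint [] = refl
  count-⊎ Q? disjoint (x ∷ xs) with P? x | Q? x
  ... | yes p | yes q = ⊥-elim (disjoint p q)
  ... | yes _ | no _  = cong suc (count-⊎ Q? disjoint xs)
  ... | no _  | yes _ = trans (cong suc (count-⊎ Q? disjoint xs)) (sym (+-suc _ _))
  ... | no _  | no _  = count-⊎ Q? disjoint xs

  count-concatMap : ∀ {m} {B : Set} (f : B → List A) (g : Fin m → B) →
                    count P? (concatMap f (tabulate g)) ≡ ∑[ i < m ] count P? (f (g i))
  count-concatMap {zero}  f g = refl
  count-concatMap {suc m} f g = trans (count-++ (f (g zero)) _) (cong (count P? (f (g zero)) +_) (count-concatMap f (g ∘ suc)))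

count-map : {A B : Set} {P : B → Set} (P? : Decidable P) (f : A → B) →
            ∀ xs → count P? (List.map f xs) ≡ count (P? ∘ f) xs
count-map P? f [] = refl
count-map P? f (x ∷ xs) with does (P? (f x))
... | true  = cong suc (count-map P? f xs)
... | false = count-map P? f xs

module _ {m : ℕ} where

  count-allVecs : ∀ {k} {P : Vec (Fin m) (suc k) → Set} (P? : Decidable P) →
                  count P? (allVecs (suc k) m) ≡ ∑[ i < m ] count (P? ∘ (i ∷_)) (allVecs k m)
  count-allVecs {k} P? = trans (count-concatMap P? (λ i → List.map (i ∷_) (allVecs k m)) (λ i → i))
    (sum-cong-≗ (λ i → count-map P? (i ∷_) (allVecs k m)))

  -- Applying a permutation of the values to every entry permutes the tables of length k,
  -- so it does not change how many of them satisfy a predicate.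
  count-permute : (π : Permutation m m) → ∀ k {P : Vec (Fin m) k → Set} (P? : Decidable P) →
                  count P? (allVecs k m) ≡ count (P? ∘ map (π ⟨$⟩ʳ_)) (allVecs k m)
  count-permute π zero    P? with does (P? [])
  ... | true  = refl
  ... | false = refl
  count-permute π (suc k) P? = begin
    count P? (allVecs (suc k) m)                                 ≡⟨ count-allVecs P? ⟩
    ∑[ i < m ] count (P? ∘ (i ∷_)) (allVecs k m)                 ≡⟨ sum-cong-≗ (λ i → count-permute π k (P? ∘ (i ∷_))) ⟩
    ∑[ i < m ] count (P? ∘ (i ∷_) ∘ map (π ⟨$⟩ʳ_)) (allVecs k m)  ≡⟨ sum-permute _ π ⟩
    ∑[ i < m ] count (P? ∘ map (π ⟨$⟩ʳ_) ∘ (i ∷_)) (allVecs k m)  ≡⟨ count-allVecs (P? ∘ map (π ⟨$⟩ʳ_)) ⟨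
    count (P? ∘ map (π ⟨$⟩ʳ_)) (allVecs (suc k) m)               ∎
    where open ≡-Reasoning

∑-point : ∀ m a → ∑[ i < m ] 𝟙 (toℕ i ≟ a) ≡ 𝟙 (a <? m)
∑-point zero a = refl
∑-point (suc m) zero = cong suc (sum-replicate-zero m)
∑-point (suc m) (suc a) = ∑-point m a

∑-interval : ∀ {m lo c} → lo ≤ c → c ≤ m →
             ∑[ i < m ] 𝟙 ((lo ≤? toℕ i) ×-dec (toℕ i <? c)) ≡ c ∸ lo
∑-interval {zero} z≤n z≤n = refl
∑-interval {suc m} {zero} {zero} _ _ = ∑-interval {m} z≤n z≤n
∑-interval {suc m} {zero} {suc c} _ (s≤s c≤m) = cong suc (∑-interval {m} z≤n c≤m)
∑-interval {suc m} {suc lo} {suc c} (s≤s lo≤c) (s≤s c≤m) =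
  trans (sum-cong-≗ {m} λ j → 𝟙-cong (suc lo ≤? suc (toℕ j) ×-dec suc (toℕ j) <? suc c) (lo ≤? toℕ j ×-dec toℕ j <? c)
                                      (Product.map s≤s⁻¹ s≤s⁻¹) (Product.map s≤s s≤s))
        (∑-interval {m} lo≤c c≤m)

<∸⇒+< : ∀ {a s m} → a < m ∸ s → a + s < m
<∸⇒+< {a} {s} {m} a<m∸s with s ≤? m
... | yes s≤m = m≤o∸n⇒m+n≤o (suc a) s≤m a<m∸s
... | no s≰m with () ← subst (suc a ≤_) (m≤n⇒m∸n≡0 (<⇒≤ (≰⇒> s≰m))) a<m∸s

∑-room : ∀ m s → ∑[ a < m ] 𝟙 (toℕ a + s <? m) ≡ m ∸ s
∑-room m s = trans (sum-cong-≗ {m} room⇔below) (∑-interval z≤n (m∸n≤m m s))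
  where
  room⇔below : ∀ a → 𝟙 (toℕ a + s <? m) ≡ 𝟙 ((0 ≤? toℕ a) ×-dec (toℕ a <? m ∸ s))
  room⇔below a = 𝟙-cong (toℕ a + s <? m) ((0 ≤? toℕ a) ×-dec (toℕ a <? m ∸ s))
                         (λ lt → z≤n , m+n≤o⇒m≤o∸n (suc (toℕ a)) lt) (λ (_ , lt) → <∸⇒+< lt)

dist≡∣-∣ : ∀ {n} (x y : Fin n) → dist x y ≡ ∣ toℕ x - toℕ y ∣
dist≡∣-∣ x y = trans (cong ℤ.∣_∣ (ℤ.[+m]-[+n]≡m⊖n (toℕ x) (toℕ y))) (∣⊖∣≡∣-∣ (toℕ x) (toℕ y))
  where
  ∣⊖∣≡∣-∣ : ∀ a b → ℤ.∣ a ℤ.⊖ b ∣ ≡ ∣ a - b ∣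
  ∣⊖∣≡∣-∣ a b with ≤-total a b
  ... | inj₁ a≤b = trans (ℤ.∣⊖∣-≤ a≤b) (sym (m≤n⇒∣m-n∣≡n∸m a≤b))
  ... | inj₂ b≤a = trans (ℤ.∣m⊖n∣≡∣n⊖m∣ a b) (trans (ℤ.∣⊖∣-≤ b≤a) (sym (m≤n⇒∣n-m∣≡n∸m b≤a)))

dist-suc : ∀ {n} (x y : Fin n) → dist (suc x) (suc y) ≡ dist x y
dist-suc x y = trans (dist≡∣-∣ (suc x) (suc y)) (sym (dist≡∣-∣ x y))

card-tabulate : ∀ {m} {Q : Fin m → Set} (Q? : Decidable Q) →
                ∣ Vec.tabulate (λ y → ⌊ Q? y ⌋) ∣ ≡ ∑[ y < m ] 𝟙 (Q? y)
card-tabulate {zero} Q? = refl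
card-tabulate {suc m} Q? with Q? zero
... | yes _ = cong suc (card-tabulate (Q? ∘ suc))
... | no _  = card-tabulate (Q? ∘ suc)

h-interval : ∀ {n} (α : Transformation n) lo s → lo + s < n →
  (∀ x → lo ≤ toℕ (α x) × toℕ (α x) ≤ lo + s) →
  (∀ t → lo ≤ t → t ≤ lo + s → ∃[ x ] toℕ (α x) ≡ t) → h α ≡ suc s
h-interval {n} α lo s lo+s<n inside onto = begin
  h α                                                           ≡⟨ card-tabulate (λ y → any? λ x → α x ≟ᶠ y) ⟩
  ∑[ y < n ] 𝟙 (any? λ x → α x ≟ᶠ y)                             ≡⟨ sum-cong-≗ {n} hit⇔interval ⟩
  ∑[ y < n ] 𝟙 ((lo ≤? toℕ y) ×-dec (toℕ y <? suc (lo + s)))    ≡⟨ ∑-interval (≤-trans (m≤m+n lo s) (n≤1+n _)) lo+s<n ⟩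
  suc (lo + s) ∸ lo                                             ≡⟨ cong (_∸ lo) (+-suc lo s) ⟨
  lo + suc s ∸ lo                                               ≡⟨ m+n∸m≡n lo (suc s) ⟩
  suc s                                                         ∎
  where
  open ≡-Reasoning
  hit⇔interval : ∀ y → 𝟙 (any? λ x → α x ≟ᶠ y) ≡ 𝟙 ((lo ≤? toℕ y) ×-dec (toℕ y <? suc (lo + s)))
  hit⇔interval y = 𝟙-cong (any? λ x → α x ≟ᶠ y) ((lo ≤? toℕ y) ×-dec (toℕ y <? suc (lo + s)))
                              (λ { (x , refl) → map₂ s≤s (inside x) })
                              (λ { (lo≤y , s≤s y≤lo+s) → map₂ toℕ-injective (onto (toℕ y) lo≤y y≤lo+s) })

-- Monotone maps and contractions between finite sets of possibly different sizes;
-- for square maps these are IsOrderPreserving and IsContraction of Defs.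
Monotone : ∀ {k m} → (Fin k → Fin m) → Set
Monotone f = ∀ i j → i ≤ᶠ j → f i ≤ᶠ f j

Contracting : ∀ {k m} → (Fin k → Fin m) → Set
Contracting f = ∀ i j → dist (f i) (f j) ≤ dist i j

steps⇒contracting : ∀ {k m} (f : Fin k → Fin m) →
  (∀ i j → toℕ i ≤ toℕ j → toℕ (f i) ≤ toℕ (f j) × toℕ (f j) ≤ toℕ (f i) + (toℕ j ∸ toℕ i)) →
  Contracting f
steps⇒contracting f steps i j = subst₂ _≤_ (sym (dist≡∣-∣ (f i) (f j))) (sym (dist≡∣-∣ i j)) (bound i j)
  where
  ordered : ∀ i j → toℕ i ≤ toℕ j → ∣ toℕ (f i) - toℕ (f j) ∣ ≤ ∣ toℕ i - toℕ j ∣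
  ordered i j i≤j with steps i j i≤j
  ... | fi≤fj , fj≤fi+j-i = subst₂ _≤_ (sym (m≤n⇒∣m-n∣≡n∸m fi≤fj)) (sym (m≤n⇒∣m-n∣≡n∸m i≤j))
                              (m≤n+o⇒m∸n≤o (toℕ (f j)) (toℕ (f i)) fj≤fi+j-i)
  bound : ∀ i j → ∣ toℕ (f i) - toℕ (f j) ∣ ≤ ∣ toℕ i - toℕ j ∣
  bound i j with ≤-total (toℕ i) (toℕ j)
  ... | inj₁ i≤j = ordered i j i≤j
  ... | inj₂ j≤i = subst₂ _≤_ (∣-∣-comm (toℕ (f j)) (toℕ (f i))) (∣-∣-comm (toℕ j) (toℕ i)) (ordered j i j≤i)

module _ {m : ℕ} where

  -- Walk a s w: reading the entries of w after the value a, each entry equals its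
  -- predecessor or exceeds it by one, and the latter happens exactly s times.
  data Walk : ℕ → ℕ → ∀ {k} → Vec (Fin m) k → Set where
    done : ∀ {a} → Walk a 0 []
    stay : ∀ {a s k y} {w : Vec (Fin m) k} → toℕ y ≡ a     → Walk a s w       → Walk a s (y ∷ w)
    rise : ∀ {a s k y} {w : Vec (Fin m) k} → toℕ y ≡ suc a → Walk (suc a) s w → Walk a (suc s) (y ∷ w)

  Staircase : ∀ {k} → ℕ → Vec (Fin m) (suc k) → Set
  Staircase s (x ∷ w) = Walk (toℕ x) s w

  walk-step : ∀ {a s k y} {w : Vec (Fin m) k} → Walk a s (y ∷ w) →
              a ≤ toℕ y × toℕ y ≤ suc a × ∃[ s′ ] Walk (toℕ y) s′ w
  walk-step {a} (stay refl ws) = ≤-refl , n≤1+n a , _ , ws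
  walk-step {a} {w = w} (rise {s = s′} y≡1+a ws) =
    ≤-trans (n≤1+n a) (≤-reflexive (sym y≡1+a)) , ≤-reflexive y≡1+a ,
    s′ , subst (λ b → Walk b s′ w) (sym y≡1+a) ws

  walk-≤ : ∀ {a s k} {w : Vec (Fin m) k} → Walk a s w → ∀ i → toℕ (lookup w i) ≤ a + s
  walk-≤ {a} {s} (stay refl ws) zero = m≤m+n a s
  walk-≤ (stay refl ws) (suc i) = walk-≤ ws i
  walk-≤ {a} (rise {s = s′} y≡1+a ws) zero    =
    ≤-trans (≤-reflexive y≡1+a) (≤-trans (s≤s (m≤m+n a s′)) (≤-reflexive (sym (+-suc a s′))))
  walk-≤ {a} (rise {s = s′} _ ws)      (suc i) = ≤-trans (walk-≤ ws i) (≤-reflexive (sym (+-suc a s′)))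

  walk-onto : ∀ {a s k} {w : Vec (Fin m) k} → Walk a s w → ∀ t → a < t → t ≤ a + s → ∃[ i ] toℕ (lookup w i) ≡ t
  walk-onto {a} done t a<t t≤a+0 = ⊥-elim (<⇒≱ a<t (≤-trans t≤a+0 (≤-reflexive (+-identityʳ a))))
  walk-onto (stay refl ws) t a<t t≤a+s with walk-onto ws t a<t t≤a+s
  ... | i , e = suc i , e
  walk-onto {a} (rise {s = s′} y≡1+a ws) t a<t t≤a+s with m≤n⇒m<n∨m≡n a<t
  ... | inj₂ 1+a≡t = zero , trans y≡1+a 1+a≡t
  ... | inj₁ 1+a<t with walk-onto ws t 1+a<t (≤-trans t≤a+s (≤-reflexive (+-suc a s′)))
  ...   | i , e = suc i , e

  walk-flat : ∀ {a k} {w : Vec (Fin m) k} → Walk a 0 w → ∀ i → toℕ (lookup w i) ≡ a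
  walk-flat (stay y≡a ws) zero    = y≡a
  walk-flat (stay refl ws) (suc i) = walk-flat ws i

  flat-walk : ∀ {a k} (w : Vec (Fin m) k) → (∀ i → toℕ (lookup w i) ≡ a) → Walk a 0 w
  flat-walk []      _    = done
  flat-walk (y ∷ w) flat = stay (flat zero) (flat-walk w (flat ∘ suc))

  staircase-steps : ∀ {s k} (v : Vec (Fin m) (suc k)) → Staircase s v → ∀ i j → toℕ i ≤ toℕ j →
    toℕ (lookup v i) ≤ toℕ (lookup v j) × toℕ (lookup v j) ≤ toℕ (lookup v i) + (toℕ j ∸ toℕ i)
  staircase-steps v st zero zero _ = ≤-refl , m≤m+n _ 0
  staircase-steps (x ∷ y ∷ w) st zero (suc j) _ with walk-step st
  ... | x≤y , y≤1+x , _ , st′ with staircase-steps (y ∷ w) st′ zero j z≤n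
  ...   | y≤vj , vj≤y+j =
    ≤-trans x≤y y≤vj , ≤-trans vj≤y+j (≤-trans (+-monoˡ-≤ (toℕ j) y≤1+x) (≤-reflexive (sym (+-suc (toℕ x) (toℕ j)))))
  staircase-steps (x ∷ y ∷ w) st (suc i) (suc j) (s≤s i≤j) with walk-step st
  ... | _ , _ , _ , st′ = staircase-steps (y ∷ w) st′ i j i≤j

  staircase⇒monotone-contracting : ∀ {s k} (v : Vec (Fin m) (suc k)) → Staircase s v →
                                   Monotone (lookup v) × Contracting (lookup v)
  staircase⇒monotone-contracting v st =
    (λ i j i≤j → proj₁ (staircase-steps v st i j i≤j)) , steps⇒contracting (lookup v) (staircase-steps v st)

  step-0-or-1 : ∀ {a b} → a ≤ b → ∣ a - b ∣ ≤ 1 → b ≡ a ⊎ b ≡ suc a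
  step-0-or-1 {a} {b} a≤b ∣a-b∣≤1
    with m≤n⇒m<n∨m≡n (≤-trans (m≤n+∣n-m∣ b a) (≤-trans (+-monoʳ-≤ a ∣a-b∣≤1) (≤-reflexive (+-comm a 1))))
  ... | inj₁ b<1+a = inj₁ (≤-antisym (s≤s⁻¹ b<1+a) a≤b)
  ... | inj₂ b≡1+a = inj₂ b≡1+a

  monotone-contracting⇒staircase : ∀ {k} (v : Vec (Fin m) (suc k)) →
    Monotone (lookup v) → Contracting (lookup v) → ∃[ s ] Staircase s v
  monotone-contracting⇒staircase (x ∷ [])    _    _     = 0 , done
  monotone-contracting⇒staircase (x ∷ y ∷ w) mono contr
    with monotone-contracting⇒staircase (y ∷ w) mono-tail contr-tail
       | step-0-or-1 (mono zero (suc zero) z≤n) (subst (_≤ 1) (dist≡∣-∣ x y) (contr zero (suc zero)))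
    where
    mono-tail : Monotone (lookup (y ∷ w))
    mono-tail i j = mono (suc i) (suc j) ∘ s≤s
    contr-tail : Contracting (lookup (y ∷ w))
    contr-tail i j = subst (dist (lookup (y ∷ w) i) (lookup (y ∷ w) j) ≤_) (dist-suc i j) (contr (suc i) (suc j))
  ... | s , st | inj₁ y≡x   = s , stay y≡x (subst (λ b → Walk b s w) y≡x st)
  ... | s , st | inj₂ y≡1+x = suc s , rise y≡1+x (subst (λ b → Walk b s w) y≡1+x st)

-- A staircase with s rises has image size s + 1: its image is [x, x + s] for its first entry x.
staircase-h : ∀ {k s} (v : Vec (Fin (suc k)) (suc k)) → Staircase s v → h (lookup v) ≡ suc s
staircase-h {k} {s} (x ∷ w) st = h-interval (lookup (x ∷ w)) (toℕ x) s top<n inside onto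
  where
  onto : ∀ t → toℕ x ≤ t → t ≤ toℕ x + s → ∃[ i ] toℕ (lookup (x ∷ w) i) ≡ t
  onto t x≤t t≤x+s with m≤n⇒m<n∨m≡n x≤t
  ... | inj₂ x≡t = zero , x≡t
  ... | inj₁ x<t = Product.map suc (λ e → e) (walk-onto st t x<t t≤x+s)
  inside : ∀ i → toℕ x ≤ toℕ (lookup (x ∷ w) i) × toℕ (lookup (x ∷ w) i) ≤ toℕ x + s
  inside zero    = ≤-refl , m≤m+n (toℕ x) s
  inside (suc i) = proj₁ (staircase-steps (x ∷ w) st zero (suc i) z≤n) , walk-≤ st i
  top<n : toℕ x + s < suc k
  top<n with onto (toℕ x + s) (m≤m+n (toℕ x) s) ≤-refl
  ... | i , e = subst (_< suc k) e (toℕ<n (lookup (x ∷ w) i))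

Rising : ∀ {n} → ℕ → Vec (Fin n) n → Set
Rising p v = (IsContraction (lookup v) × IsOrderPreserving (lookup v)) × h (lookup v) ≡ p

rising≐staircase : ∀ {k s} → Rising {suc k} (suc s) ≐ Staircase s
rising≐staircase {k} {s} = to , from
  where
  to : ∀ {v} → Rising (suc s) v → Staircase s v
  to {v} ((contr , mono) , h≡1+s) with monotone-contracting⇒staircase v mono contr
  ... | s′ , st = subst (λ t → Staircase t v) (suc-injective (trans (sym (staircase-h v st)) h≡1+s)) st
  from : ∀ {v} → Staircase s v → Rising (suc s) v
  from {v} st = Product.swap (staircase⇒monotone-contracting v st) , staircase-h v st

module _ {m : ℕ} where

  first-step₀ : ∀ {a k y} {w : Vec (Fin m) k} → Walk a 0 (y ∷ w) → toℕ y ≡ a × Walk a 0 w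
  first-step₀ (stay y≡a ws) = y≡a , ws

  first-step : ∀ {a s k y} {w : Vec (Fin m) k} → Walk a (suc s) (y ∷ w) →
               (toℕ y ≡ a × Walk a (suc s) w) ⊎ (toℕ y ≡ suc a × Walk (suc a) s w)
  first-step (stay y≡a ws)   = inj₁ (y≡a , ws)
  first-step (rise y≡1+a ws) = inj₂ (y≡1+a , ws)

  walk? : ∀ {k} a s (w : Vec (Fin m) k) → Dec (Walk a s w)
  walk? a zero    []      = yes done
  walk? a (suc s) []      = no λ ()
  walk? a zero    (y ∷ w) = map′ (uncurry stay) first-step₀ ((toℕ y ≟ a) ×-dec walk? a zero w)
  walk? a (suc s) (y ∷ w) = map′ [ uncurry stay , uncurry rise ]′ first-step
    (((toℕ y ≟ a) ×-dec walk? a (suc s) w) ⊎-dec ((toℕ y ≟ suc a) ×-dec walk? (suc a) s w))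

  staircase? : ∀ {k} s (v : Vec (Fin m) (suc k)) → Dec (Staircase s v)
  staircase? s (x ∷ w) = walk? (toℕ x) s w

  count-heads : ∀ {k} a {P : Vec (Fin m) k → Set} (P? : Decidable P) xs →
    ∑[ i < m ] count (λ w → (toℕ i ≟ a) ×-dec P? w) xs ≡ 𝟙 (a <? m) * count P? xs
  count-heads a P? xs = begin
    ∑[ i < m ] count (λ w → (toℕ i ≟ a) ×-dec P? w) xs  ≡⟨ sum-cong-≗ {m} (λ i → count-guard P? (toℕ i ≟ a) xs) ⟩
    ∑[ i < m ] (𝟙 (toℕ i ≟ a) * count P? xs)           ≡⟨ *-distribʳ-sum {m} (count P? xs) (λ i → 𝟙 (toℕ i ≟ a)) ⟨
    (∑[ i < m ] 𝟙 (toℕ i ≟ a)) * count P? xs           ≡⟨ cong (_* count P? xs) (∑-point m a) ⟩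
    𝟙 (a <? m) * count P? xs                           ∎
    where open ≡-Reasoning

  -- The walks of length k from a < m with s rises: choose which s steps rise, provided
  -- the final value a + s still lies below m.
  count-walks : ∀ k a s → a < m → count (walk? a s) (allVecs k m) ≡ 𝟙 (a + s <? m) * (k C s)
  count-walks zero a zero a<m =
    sym (trans (*-identityʳ _) (𝟙-yes (a + 0 <? m) (subst (_< m) (sym (+-identityʳ a)) a<m)))
  count-walks zero a (suc s) a<m = sym (*-zeroʳ (𝟙 (a + suc s <? m)))
  count-walks (suc k) a zero a<m = begin
    count (walk? a 0) (allVecs (suc k) m)                         ≡⟨ count-allVecs (walk? a 0) ⟩
    ∑[ i < m ] count (walk? a 0 ∘ (i ∷_)) V                       ≡⟨ sum-cong-≗ {m} (λ i → count-cong _ _ (first-step₀ , uncurry stay) V) ⟩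
    ∑[ i < m ] count (λ w → (toℕ i ≟ a) ×-dec walk? a 0 w) V      ≡⟨ count-heads a (walk? a 0) V ⟩
    𝟙 (a <? m) * count (walk? a 0) V                              ≡⟨ cong (_* count (walk? a 0) V) (𝟙-yes (a <? m) a<m) ⟩
    1 * count (walk? a 0) V                                       ≡⟨ *-identityˡ _ ⟩
    count (walk? a 0) V                                           ≡⟨ count-walks k a 0 a<m ⟩
    𝟙 (a + 0 <? m) * (k C 0)                                      ∎
    where
    open ≡-Reasoning
    V = allVecs k m
  count-walks (suc k) a (suc s) a<m = begin
    count (walk? a (suc s)) (allVecs (suc k) m)
      ≡⟨ count-allVecs (walk? a (suc s)) ⟩
    ∑[ i < m ] count (walk? a (suc s) ∘ (i ∷_)) V
      ≡⟨ sum-cong-≗ {m} (λ i → trans (count-cong _ _ (first-step , [ uncurry stay , uncurry rise ]′) V)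
                                     (count-⊎ (stays i) (rises i) (λ (e , _) (e′ , _) → 1+n≢n (trans (sym e′) e)) V)) ⟩
    ∑[ i < m ] (count (stays i) V + count (rises i) V)
      ≡⟨ ∑-distrib-+ (λ i → count (stays i) V) (λ i → count (rises i) V) ⟩
    ∑[ i < m ] count (stays i) V + ∑[ i < m ] count (rises i) V
      ≡⟨ cong₂ _+_ (count-heads a (walk? a (suc s)) V) (count-heads (suc a) (walk? (suc a) s) V) ⟩
    𝟙 (a <? m) * count (walk? a (suc s)) V + 𝟙 (suc a <? m) * count (walk? (suc a) s) V
      ≡⟨ cong₂ _+_ staying rising ⟩
    𝟙 (a + suc s <? m) * (k C suc s) + 𝟙 (suc a + s <? m) * (k C s)
      ≡⟨ cong (λ t → 𝟙 (t <? m) * (k C suc s) + 𝟙 (suc a + s <? m) * (k C s)) (+-suc a s) ⟩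
    𝟙 (suc a + s <? m) * (k C suc s) + 𝟙 (suc a + s <? m) * (k C s)
      ≡⟨ *-distribˡ-+ (𝟙 (suc a + s <? m)) (k C suc s) (k C s) ⟨
    𝟙 (suc a + s <? m) * (k C suc s + k C s)
      ≡⟨ cong (𝟙 (suc a + s <? m) *_) (trans (+-comm (k C suc s) (k C s)) (nCk+nC[k+1]≡[n+1]C[k+1] k s)) ⟩
    𝟙 (suc a + s <? m) * (suc k C suc s)
      ≡⟨ cong (λ t → 𝟙 (t <? m) * (suc k C suc s)) (+-suc a s) ⟨
    𝟙 (a + suc s <? m) * (suc k C suc s) ∎
    where
    open ≡-Reasoning
    V = allVecs k m
    stays : ∀ i → Decidable (λ w → toℕ i ≡ a × Walk a (suc s) w)
    rises : ∀ i → Decidable (λ w → toℕ i ≡ suc a × Walk (suc a) s w)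
    stays i w = (toℕ i ≟ a) ×-dec walk? a (suc s) w
    rises i w = (toℕ i ≟ suc a) ×-dec walk? (suc a) s w
    staying : 𝟙 (a <? m) * count (walk? a (suc s)) V ≡ 𝟙 (a + suc s <? m) * (k C suc s)
    staying = trans (cong (_* count (walk? a (suc s)) V) (𝟙-yes (a <? m) a<m))
                    (trans (*-identityˡ _) (count-walks k a (suc s) a<m))
    rising : 𝟙 (suc a <? m) * count (walk? (suc a) s) V ≡ 𝟙 (suc a + s <? m) * (k C s)
    rising with suc a <? m
    ... | yes 1+a<m = trans (cong (_* count (walk? (suc a) s) V) (𝟙-yes (suc a <? m) 1+a<m))
                            (trans (*-identityˡ _) (count-walks k (suc a) s 1+a<m))
    ... | no 1+a≮m  = trans (cong (_* count (walk? (suc a) s) V) (𝟙-no (suc a <? m) 1+a≮m))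
                            (sym (cong (_* (k C s)) (𝟙-no (suc a + s <? m) (1+a≮m ∘ ≤-trans (s≤s (s≤s (m≤m+n a s)))))))

count-staircases : ∀ m k s → count (staircase? s) (allVecs (suc k) m) ≡ (m ∸ s) * (k C s)
count-staircases m k s = begin
  count (staircase? s) (allVecs (suc k) m)          ≡⟨ count-allVecs {m} (staircase? s) ⟩
  ∑[ a < m ] count (walk? (toℕ a) s) (allVecs k m)  ≡⟨ sum-cong-≗ {m} (λ a → count-walks k (toℕ a) s (toℕ<n a)) ⟩
  ∑[ a < m ] (𝟙 (toℕ a + s <? m) * (k C s))         ≡⟨ *-distribʳ-sum {m} (k C s) (λ a → 𝟙 (toℕ a + s <? m)) ⟨
  (∑[ a < m ] 𝟙 (toℕ a + s <? m)) * (k C s)         ≡⟨ cong (_* (k C s)) (∑-room m s) ⟩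
  (m ∸ s) * (k C s)                                 ∎
  where open ≡-Reasoning

∣-∣-reflect : ∀ {n a b} → a ≤ n → b ≤ n → ∣ (n ∸ a) - (n ∸ b) ∣ ≡ ∣ a - b ∣
∣-∣-reflect {n} {a} {b} a≤n b≤n = begin
  ∣ (n ∸ a) - (n ∸ b) ∣                       ≡⟨ ∣m+n-m+o∣≡∣n-o∣ (a + b) (n ∸ a) (n ∸ b) ⟨
  ∣ a + b + (n ∸ a) - a + b + (n ∸ b) ∣       ≡⟨ cong₂ ∣_-_∣ (complete (+-comm a b) a≤n) (complete refl b≤n) ⟩
  ∣ b + n - a + n ∣                           ≡⟨ cong₂ ∣_-_∣ (+-comm b n) (+-comm a n) ⟩
  ∣ n + b - n + a ∣                           ≡⟨ ∣m+n-m+o∣≡∣n-o∣ n b a ⟩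
  ∣ b - a ∣                                   ≡⟨ ∣-∣-comm b a ⟩
  ∣ a - b ∣                                   ∎
  where
  open ≡-Reasoning
  complete : ∀ {y x c} → y ≡ x + c → c ≤ n → y + (n ∸ c) ≡ x + n
  complete {y} {x} {c} y≡x+c c≤n = begin
    y + (n ∸ c)       ≡⟨ cong (_+ (n ∸ c)) y≡x+c ⟩
    x + c + (n ∸ c)   ≡⟨ +-assoc x c (n ∸ c) ⟩
    x + (c + (n ∸ c)) ≡⟨ cong (x +_) (m+[n∸m]≡n c≤n) ⟩
    x + n             ∎

opposite-antitone : ∀ {n} {x y : Fin n} → x ≤ᶠ y → opposite y ≤ᶠ opposite x
opposite-antitone {n} {x} {y} x≤y =
  subst₂ _≤_ (sym (opposite-prop y)) (sym (opposite-prop x)) (∸-monoʳ-≤ n (s≤s x≤y))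

dist-opposite : ∀ {n} (x y : Fin n) → dist (opposite x) (opposite y) ≡ dist x y
dist-opposite {suc n} x y = begin
  dist (opposite x) (opposite y)                    ≡⟨ dist≡∣-∣ (opposite x) (opposite y) ⟩
  ∣ toℕ (opposite x) - toℕ (opposite y) ∣           ≡⟨ cong₂ ∣_-_∣ (opposite-prop x) (opposite-prop y) ⟩
  ∣ (n ∸ toℕ x) - (n ∸ toℕ y) ∣                     ≡⟨ ∣-∣-reflect (toℕ≤pred x) (toℕ≤pred y) ⟩
  ∣ toℕ x - toℕ y ∣                                 ≡⟨ dist≡∣-∣ x y ⟨
  dist x y                                          ∎
  where
  open ≡-Reasoning
  toℕ≤pred : (x : Fin (suc n)) → toℕ x ≤ n
  toℕ≤pred x = s≤s⁻¹ (toℕ<n x)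

module Reflected {n} (f g : Transformation n) (g≗ : ∀ x → g x ≡ opposite (f x)) where

  dist-g : ∀ x y → dist (g x) (g y) ≡ dist (f x) (f y)
  dist-g x y = trans (cong₂ dist (g≗ x) (g≗ y)) (dist-opposite (f x) (f y))

  contraction⇒ : IsContraction f → IsContraction g
  contraction⇒ contr x y = subst (_≤ dist x y) (sym (dist-g x y)) (contr x y)

  contraction⇐ : IsContraction g → IsContraction f
  contraction⇐ contr x y = subst (_≤ dist x y) (dist-g x y) (contr x y)

  reversing⇒preserving : IsOrderReversing f → IsOrderPreserving g
  reversing⇒preserving rev x y x≤y =
    subst₂ _≤ᶠ_ (sym (g≗ x)) (sym (g≗ y)) (opposite-antitone (rev x y x≤y))

  preserving⇒reversing : IsOrderPreserving g → IsOrderReversing f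
  preserving⇒reversing mono x y x≤y =
    subst₂ _≤ᶠ_ (opposite-involutive (f y)) (opposite-involutive (f x))
      (opposite-antitone (subst₂ _≤ᶠ_ (g≗ x) (g≗ y) (mono x y x≤y)))

  h-reflected : h g ≡ h f
  h-reflected = begin
    h g                                              ≡⟨ card-tabulate (λ y → any? λ x → g x ≟ᶠ y) ⟩
    ∑[ y < n ] 𝟙 (any? λ x → g x ≟ᶠ y)                ≡⟨ sum-permute (λ y → 𝟙 (any? λ x → g x ≟ᶠ y)) Perm.reverse ⟩
    ∑[ y < n ] 𝟙 (any? λ x → g x ≟ᶠ opposite y)       ≡⟨ sum-cong-≗ {n} hits ⟩
    ∑[ y < n ] 𝟙 (any? λ x → f x ≟ᶠ y)                ≡⟨ card-tabulate (λ y → any? λ x → f x ≟ᶠ y) ⟨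
    h f                                              ∎
    where
    open ≡-Reasoning
    hits : ∀ y → 𝟙 (any? λ x → g x ≟ᶠ opposite y) ≡ 𝟙 (any? λ x → f x ≟ᶠ y)
    hits y = 𝟙-cong (any? λ x → g x ≟ᶠ opposite y) (any? λ x → f x ≟ᶠ y)
      (λ (x , gx≡y′) → x , trans (sym (opposite-involutive (f x)))
                               (trans (cong opposite (trans (sym (g≗ x)) gx≡y′)) (opposite-involutive y)))
      (λ (x , fx≡y) → x , trans (g≗ x) (cong opposite fx≡y))

Falling : ∀ {n} → ℕ → Vec (Fin n) n → Set
Falling p v = (IsContraction (lookup v) × IsOrderReversing (lookup v)) × h (lookup v) ≡ p

rising? : ∀ {n} p → Decidable (Rising {n} p)
rising? p v = (isContraction? (lookup v) ×-dec isOrderPreserving? (lookup v)) ×-dec (h (lookup v) ≟ p)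

falling? : ∀ {n} p → Decidable (Falling {n} p)
falling? p v = (isContraction? (lookup v) ×-dec isOrderReversing? (lookup v)) ×-dec (h (lookup v) ≟ p)

falling≐reflected-rising : ∀ {n p} → Falling {n} p ≐ Rising p ∘ map opposite
falling≐reflected-rising {n} {p} =
  (λ {v} ((contr , rev) , hv≡p) → let open Reflected-table v in
     (contraction⇒ contr , reversing⇒preserving rev) , trans h-reflected hv≡p) ,
  (λ {v} ((contr , mono) , hv≡p) → let open Reflected-table v in
     (contraction⇐ contr , preserving⇒reversing mono) , trans (sym h-reflected) hv≡p)
  where
  module Reflected-table (v : Vec (Fin n) n) = Reflected (lookup v) (lookup (map opposite v)) (λ x → lookup-map x opposite v)

countORCT≡count-rising-or-falling : ∀ n p →
  countORCT n p ≡ count (λ v → rising? p v ⊎-dec falling? p v) (allVecs n n)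
countORCT≡count-rising-or-falling n p =
  trans (count-map (λ α → inORCT? α ×-dec (h α ≟ p)) lookup (allVecs n n))
        (count-cong _ _ ((λ {v} → split {v}) , (λ {v} → join {v})) (allVecs n n))
  where
  split : ∀ {v} → InORCT (lookup v) × h (lookup v) ≡ p → Rising p v ⊎ Falling p v
  split ((contr , inj₁ mono) , hv≡p) = inj₁ ((contr , mono) , hv≡p)
  split ((contr , inj₂ rev)  , hv≡p) = inj₂ ((contr , rev) , hv≡p)
  join : ∀ {v} → Rising p v ⊎ Falling p v → InORCT (lookup v) × h (lookup v) ≡ p
  join (inj₁ ((contr , mono) , hv≡p)) = (contr , inj₁ mono) , hv≡p
  join (inj₂ ((contr , rev) , hv≡p))  = (contr , inj₂ rev) , hv≡p

count-rising : ∀ k s → count (rising? (suc s)) (allVecs (suc k) (suc k)) ≡ (suc k ∸ s) * (k C s)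
count-rising k s =
  trans (count-cong (rising? (suc s)) (staircase? s) (rising≐staircase {k} {s}) (allVecs (suc k) (suc k)))
        (count-staircases (suc k) k s)

-- The reflection is a bijection on tables, so there are as many falling as rising ones.
count-falling : ∀ n p → count (falling? p) (allVecs n n) ≡ count (rising? p) (allVecs n n)
count-falling n p = trans (count-cong (falling? p) (rising? p ∘ map opposite) falling≐reflected-rising (allVecs n n))
                          (sym (count-permute Perm.reverse n (rising? p)))

-- A table that is both order-preserving and order-reversing is constant, so it has image size 1.
rising-and-falling⇒h≡1 : ∀ {k p} (v : Vec (Fin (suc k)) (suc k)) → Rising p v → Falling p v → p ≡ 1
rising-and-falling⇒h≡1 (x ∷ w) ((_ , mono) , hv≡p) ((_ , rev) , _) =
  trans (sym hv≡p) (staircase-h (x ∷ w) (flat-walk w λ i → cong toℕ (flat (suc i))))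
  where
  flat : ∀ i → lookup (x ∷ w) i ≡ x
  flat i = ≤ᶠ-antisym (rev zero i z≤n) (mono zero i z≤n)

-- A falling table with image size 1 is constant, hence also rising.
falling₁⇒rising₁ : ∀ {k} (v : Vec (Fin (suc k)) (suc k)) → Falling 1 v → Rising 1 v
falling₁⇒rising₁ {k} (x ∷ w) falling@((contr , _) , hv≡1) = (contr , mono) , hv≡1
  where
  reflected-flat : ∀ i → toℕ (lookup (map opposite w) i) ≡ toℕ (opposite x)
  reflected-flat =
    walk-flat (proj₁ (rising≐staircase {k} {0}) {map opposite (x ∷ w)} (proj₁ falling≐reflected-rising {x ∷ w} falling))
  flat : ∀ i → lookup (x ∷ w) i ≡ x
  flat zero    = refl
  flat (suc i) = trans (sym (opposite-involutive (lookup w i)))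
                   (trans (cong opposite (trans (sym (lookup-map i opposite w)) (toℕ-injective (reflected-flat i))))
                          (opposite-involutive x))
  mono : IsOrderPreserving (lookup (x ∷ w))
  mono i j _ = ≤-reflexive (cong toℕ (trans (flat i) (sym (flat j))))

countORCT-1 : ∀ k → countORCT (suc k) 1 ≡ suc k
countORCT-1 k = begin
  countORCT (suc k) 1                              ≡⟨ countORCT≡count-rising-or-falling (suc k) 1 ⟩
  count (λ v → rising? 1 v ⊎-dec falling? 1 v) T   ≡⟨ count-cong _ (rising? 1) ((λ {v} → falling-absorbed {v}) , inj₁) T ⟩
  count (rising? 1) T                              ≡⟨ count-rising k 0 ⟩
  suc k * 1                                        ≡⟨ *-identityʳ (suc k) ⟩
  suc k                                            ∎
  where
  open ≡-Reasoning
  T = allVecs (suc k) (suc k)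
  falling-absorbed : ∀ {v} → Rising 1 v ⊎ Falling 1 v → Rising 1 v
  falling-absorbed     (inj₁ rising)  = rising
  falling-absorbed {v} (inj₂ falling) = falling₁⇒rising₁ v falling

countORCT-2+ : ∀ k s → countORCT (suc k) (2 + s) ≡ 2 * ((k ∸ s) * (k C suc s))
countORCT-2+ k s = begin
  countORCT (suc k) (2 + s)                                ≡⟨ countORCT≡count-rising-or-falling (suc k) (2 + s) ⟩
  count (λ v → rising? (2 + s) v ⊎-dec falling? (2 + s) v) T
    ≡⟨ count-⊎ (rising? (2 + s)) (falling? (2 + s)) (λ {v} → disjoint {v}) T ⟩
  R + count (falling? (2 + s)) T                           ≡⟨ cong (R +_) (count-falling (suc k) (2 + s)) ⟩
  R + R                                                    ≡⟨ cong (R +_) (+-identityʳ R) ⟨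
  2 * R                                                    ≡⟨ cong (2 *_) (count-rising k (suc s)) ⟩
  2 * ((k ∸ s) * (k C suc s))                              ∎
  where
  open ≡-Reasoning
  T = allVecs (suc k) (suc k)
  R = count (rising? (2 + s)) T
  disjoint : ∀ {v} → Rising (2 + s) v → Falling (2 + s) v → ⊥
  disjoint {v} rising falling = 1+n≢0 (suc-injective (rising-and-falling⇒h≡1 v rising falling))

corollary3p4 : (n p : ℕ) → 1 ≤ n → 1 ≤ p → p ≤ n →
    (1 < p → countORCT n p ≡ 2 * (n ∸ p + 1) * ((n ∸ 1) C (p ∸ 1))) ×
    (p ≡ 1 → countORCT n p ≡ n)
corollary3p4 (suc k) (suc zero) _ _ _ = (λ { (s≤s ()) }) , λ _ → countORCT-1 k
corollary3p4 (suc k) (suc (suc s)) _ _ (s≤s s<k) = (λ _ → begin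
  countORCT (suc k) (2 + s)             ≡⟨ countORCT-2+ k s ⟩
  2 * ((k ∸ s) * (k C suc s))           ≡⟨ cong (λ t → 2 * (t * (k C suc s))) k∸s≡k∸[1+s]+1 ⟩
  2 * ((k ∸ suc s + 1) * (k C suc s))   ≡⟨ *-assoc 2 (k ∸ suc s + 1) (k C suc s) ⟨
  2 * (k ∸ suc s + 1) * (k C suc s)     ∎) , λ ()
  where
  open ≡-Reasoning
  k∸s≡k∸[1+s]+1 : k ∸ s ≡ k ∸ suc s + 1
  k∸s≡k∸[1+s]+1 = trans (+-∸-assoc 1 s<k) (+-comm 1 (k ∸ suc s))
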